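{- Let $s\ge1$, $S=\{0,1,\dots,s-1\}$, $n\ge1$, and let $I$ be a mapping on $S^n$ and $0\le i<j<s^n-1$ be such that $I$ preserves the strict ordering of the consecutive vectors $X_i,X_{i+1},\dots,X_j$, i.e. the indices of $I(X_i),I(X_{i+1}),\dots,I(X_j)$ are strictly increasing. Then there is an in situ program with signature $n,n-1,\dots,1$ computing a mapping $J$ on $S^n$ whose restriction to $\{X_i,\dots,X_j\}$ equals that of $I$.
   Context: An in situ program of a mapping $J:S^n\to S^n$ is a finite sequence $(\psi_1,i_1),\dots,(\psi_m,i_m)$ with $\psi_k:S^n\to S$ and $i_k\in\{1,\dots,n\}$ such that for every $X\in S^n$, setting $X_0=X$ and letting $X_k$ be the vector equal to $X_{k-1}$ except that its $i_k$-th component is replaced by $\psi_k(X_{k-1})$, one has $X_m=J(X)$; its signature is $i_1,\dots,i_m$. The index of $(x_1,\dots,x_n)\in S^n$ is $x_1+s x_2+\dots+s^{n-1}x_n$, and $X_l$ denotes the vector of index $l$. -}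

module Defs where

open import Data.Nat using (ℕ; zero; suc; _+_; _*_; _^_; _<_; _≤_)
open import Data.Nat.DivMod using (_/_; _%_)
open import Data.Nat.Properties using ()
open import Data.Fin using (Fin; toℕ; fromℕ<)
open import Data.Fin.Properties using ()
open import Data.Nat.DivMod using (m%n<n)
open import Data.Vec using (Vec; []; _∷_; updateAt; _[_]≔_)
open import Data.List using (List; []; _∷_; map; reverse; allFin)
open import Data.Product using (_×_; _,_; proj₂)

-- S = {0,…,s-1} is Fin s; S^n is Vec (Fin s) n, with the k-th component
-- x_k (1-based) stored at position k-1 of the vector.

index : {s n : ℕ} → Vec (Fin s) n → ℕ
index {s} [] = 0
index {s} (x ∷ xs) = toℕ x + s * index xs

-- the vector of index l (base-s digits, least significant first), for S = Fin (suc s')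
-- (only meaningful for l < s^n; higher digits are discarded)
vecOfIndex : (s' n : ℕ) → ℕ → Vec (Fin (suc s')) n
vecOfIndex s' zero l = []
vecOfIndex s' (suc n) l = fromℕ< (m%n<n l (suc s')) ∷ vecOfIndex s' n (l / suc s')

-- an in situ program: a list of steps (ψ_k , i_k); the component position
-- i_k ∈ {1,…,n} is represented by the 0-based position i_k - 1 : Fin n
Step : ℕ → ℕ → Set
Step s n = (Vec (Fin s) n → Fin s) × Fin n

Program : ℕ → ℕ → Set
Program s n = List (Step s n)

run : {s n : ℕ} → Program s n → Vec (Fin s) n → Vec (Fin s) n
run [] X = X
run ((ψ , i) ∷ p) X = run p (X [ i ]≔ ψ X)

signature : {s n : ℕ} → Program s n → List (Fin n)
signature = map proj₂

-- the signature n, n-1, …, 1 (as 0-based positions n-1, …, 0)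
descendingSignature : (n : ℕ) → List (Fin n)
descendingSignature n = reverse (allFin n)

-- Follow the states the program passes through: just before it overwrites
-- component q, the state is X_k with its components q+1,…,n replaced by those
-- of I(X_k). Such a state still determines k on {i,…,j}: if the states of
-- k < k' agreed, X_k and X_k' would share their q low digits, forcing
-- k' - k ≥ s^q, while I(X_k) and I(X_k') would share their digits from q+1 on,
-- so index I(X_k') - index I(X_k) < s^q. But strict monotonicity gives
-- index I(X_k') - index I(X_k) ≥ k' - k. Hence the step writing component q
-- can recover k by search and write the q-th component of I(X_k).
module Submission where

open import Defs
open import Data.Nat using (ℕ; zero; suc; _+_; _*_; _∸_; _^_; _<_; _≤_; z≤n; s≤s)
open import Data.Nat.Properties
open import Data.Nat.DivMod using (_/_; _%_; m%n<n; m≡m%n+[m/n]*n; m<n*o⇒m/o<n)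
open import Data.Fin using (Fin; toℕ; fromℕ<)
open import Data.Fin.Properties using (toℕ<n; toℕ-fromℕ<)
open import Data.Vec using (Vec; []; _∷_; lookup; _[_]≔_)
open import Data.Vec.Properties using (≡-dec)
open import Data.List using (List; []; _∷_; map; reverse; allFin; tabulate; applyUpTo; downFrom)
open import Data.List.Properties using (map-∘; map-id; reverse-map; reverse-upTo; ∷-injective)
open import Data.Product using (Σ; _×_; _,_)
open import Data.Empty using (⊥-elim)
open import Data.Sum using (inj₁; inj₂)
open import Function using (_∘_)
open import Relation.Nullary using (yes; no)
open import Relation.Binary.Definitions using (DecidableEquality; tri<; tri≈; tri>)
open import Relation.Binary.PropositionalEquality

index-vecOfIndex : (s' n k : ℕ) → k < suc s' ^ n → index (vecOfIndex s' n k) ≡ k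
index-vecOfIndex s' zero zero    _           = refl
index-vecOfIndex s' zero (suc k) (s≤s ())
index-vecOfIndex s' (suc n) k k<S^n = begin
    toℕ (fromℕ< (m%n<n k S)) + S * index (vecOfIndex s' n (k / S))
  ≡⟨ cong₂ (λ a b → a + S * b) (toℕ-fromℕ< (m%n<n k S))
       (index-vecOfIndex s' n (k / S) (m<n*o⇒m/o<n (subst (k <_) (*-comm S (S ^ n)) k<S^n))) ⟩
    k % S + S * (k / S)
  ≡⟨ cong (k % S +_) (*-comm S (k / S)) ⟩
    k % S + k / S * S
  ≡⟨ sym (m≡m%n+[m/n]*n k S) ⟩
    k ∎
  where
  open ≡-Reasoning
  S = suc s'

lowPart : {s n : ℕ} → ℕ → Vec (Fin s) n → ℕ
lowPart     zero    V       = 0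
lowPart     (suc p) []      = 0
lowPart {s} (suc p) (x ∷ V) = toℕ x + s * lowPart p V

highPart : {s n : ℕ} → ℕ → Vec (Fin s) n → ℕ
highPart zero    V       = index V
highPart (suc p) []      = 0
highPart (suc p) (x ∷ V) = highPart p V

index-split : {s n : ℕ} (p : ℕ) (V : Vec (Fin s) n) →
  index V ≡ lowPart p V + s ^ p * highPart p V
index-split zero    V = sym (+-identityʳ (index V))
index-split {s} (suc p) [] = sym (*-zeroʳ (s ^ suc p))
index-split {s} (suc p) (x ∷ V) = begin
    toℕ x + s * index V
  ≡⟨ cong (λ t → toℕ x + s * t) (index-split p V) ⟩
    toℕ x + s * (lowPart p V + s ^ p * highPart p V)
  ≡⟨ cong (toℕ x +_) (*-distribˡ-+ s (lowPart p V) _) ⟩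
    toℕ x + (s * lowPart p V + s * (s ^ p * highPart p V))
  ≡⟨ sym (+-assoc (toℕ x) _ _) ⟩
    toℕ x + s * lowPart p V + s * (s ^ p * highPart p V)
  ≡⟨ cong (toℕ x + s * lowPart p V +_) (sym (*-assoc s (s ^ p) (highPart p V))) ⟩
    toℕ x + s * lowPart p V + s * s ^ p * highPart p V ∎
  where open ≡-Reasoning

lowPart<s^p : {s n : ℕ} (p : ℕ) (V : Vec (Fin (suc s)) n) → lowPart p V < suc s ^ p
lowPart<s^p zero    V = s≤s z≤n
lowPart<s^p {s} (suc p) [] = m^n>0 (suc s) (suc p)
lowPart<s^p {s} (suc p) (x ∷ V) = begin-strict
    toℕ x + S * lowPart p V
  <⟨ +-monoˡ-< (S * lowPart p V) (toℕ<n x) ⟩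
    S + S * lowPart p V
  ≡⟨ cong (_+ S * lowPart p V) (sym (*-identityʳ S)) ⟩
    S * 1 + S * lowPart p V
  ≡⟨ sym (*-distribˡ-+ S 1 (lowPart p V)) ⟩
    S * suc (lowPart p V)
  ≤⟨ *-monoʳ-≤ S (lowPart<s^p p V) ⟩
    S * S ^ p ∎
  where
  open ≤-Reasoning
  S = suc s

gap-between-multiples : ∀ m a b e → m * a + e ≡ m * b → 0 < e → m ≤ e
gap-between-multiples m a b e eq 0<e = +-cancelˡ-≤ (m * a) m e (begin
    m * a + m   ≡⟨ +-comm (m * a) m ⟩
    m + m * a   ≡⟨ sym (*-suc m a) ⟩
    m * suc a   ≤⟨ *-monoʳ-≤ m a<b ⟩
    m * b       ≡⟨ sym eq ⟩
    m * a + e   ∎)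
  where
  open ≤-Reasoning
  a<b : a < b
  a<b = *-cancelˡ-< m a b (subst (m * a <_) eq (m<m+n (m * a) 0<e))

sameLowPart⇒s^p≤gap : {s n : ℕ} (p e : ℕ) (V W : Vec (Fin (suc s)) n) →
  lowPart p V ≡ lowPart p W → index V + e ≡ index W → 0 < e → suc s ^ p ≤ e
sameLowPart⇒s^p≤gap {s} p e V W same gap 0<e =
  gap-between-multiples (suc s ^ p) (highPart p V) (highPart p W) e
    (+-cancelˡ-≡ (lowPart p V) _ _ (begin
      lowPart p V + (suc s ^ p * highPart p V + e)  ≡⟨ sym (+-assoc (lowPart p V) _ e) ⟩
      lowPart p V + suc s ^ p * highPart p V + e    ≡⟨ cong (_+ e) (sym (index-split p V)) ⟩
      index V + e                                   ≡⟨ gap ⟩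
      index W                                       ≡⟨ index-split p W ⟩
      lowPart p W + suc s ^ p * highPart p W        ≡⟨ cong (_+ _) (sym same) ⟩
      lowPart p V + suc s ^ p * highPart p W        ∎))
    0<e
  where open ≡-Reasoning

sameHighPart⇒gap<s^p : {s n : ℕ} (p e : ℕ) (V W : Vec (Fin (suc s)) n) →
  highPart p V ≡ highPart p W → index V + e ≤ index W → e < suc s ^ p
sameHighPart⇒gap<s^p {s} p e V W same gap = begin-strict
    e                ≤⟨ m≤n+m e (lowPart p V) ⟩
    lowPart p V + e  ≤⟨ +-cancelʳ-≤ H _ _ shifted ⟩
    lowPart p W      <⟨ lowPart<s^p p W ⟩
    suc s ^ p        ∎
  where
  open ≤-Reasoning
  H = suc s ^ p * highPart p V
  shifted : lowPart p V + e + H ≤ lowPart p W + H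
  shifted = begin
    lowPart p V + e + H  ≡⟨ +-assoc (lowPart p V) e H ⟩
    lowPart p V + (e + H) ≡⟨ cong (lowPart p V +_) (+-comm e H) ⟩
    lowPart p V + (H + e) ≡⟨ sym (+-assoc (lowPart p V) H e) ⟩
    lowPart p V + H + e  ≡⟨ cong (_+ e) (sym (index-split p V)) ⟩
    index V + e          ≤⟨ gap ⟩
    index W              ≡⟨ index-split p W ⟩
    lowPart p W + suc s ^ p * highPart p W ≡⟨ cong (λ h → lowPart p W + suc s ^ p * h) (sym same) ⟩
    lowPart p W + H      ∎

splice : {A : Set} {n : ℕ} → ℕ → Vec A n → Vec A n → Vec A n
splice zero    X       Y       = Y
splice (suc p) []      []      = []
splice (suc p) (x ∷ X) (y ∷ Y) = x ∷ splice p X Y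

splice-full : {A : Set} {n : ℕ} (X Y : Vec A n) → splice n X Y ≡ X
splice-full []      []      = refl
splice-full (x ∷ X) (y ∷ Y) = cong (x ∷_) (splice-full X Y)

splice-update : {A : Set} {n : ℕ} (q : Fin n) (X Y : Vec A n) →
  splice (suc (toℕ q)) X Y [ q ]≔ lookup Y q ≡ splice (toℕ q) X Y
splice-update Fin.zero    (x ∷ X) (y ∷ Y) = refl
splice-update (Fin.suc q) (x ∷ X) (y ∷ Y) = cong (x ∷_) (splice-update q X Y)

lowPart-splice : {s n : ℕ} (p : ℕ) (X Y : Vec (Fin s) n) → lowPart p (splice p X Y) ≡ lowPart p X
lowPart-splice zero    X       Y       = refl
lowPart-splice (suc p) []      []      = refl
lowPart-splice {s} (suc p) (x ∷ X) (y ∷ Y) = cong (λ l → toℕ x + s * l) (lowPart-splice p X Y)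

highPart-splice : {s n : ℕ} (p : ℕ) (X Y : Vec (Fin s) n) → highPart p (splice p X Y) ≡ highPart p Y
highPart-splice zero    X       Y       = refl
highPart-splice (suc p) []      []      = refl
highPart-splice (suc p) (x ∷ X) (y ∷ Y) = highPart-splice p X Y

run-descending : {s n : ℕ} (ψ : Fin n → Vec (Fin s) n → Fin s) (X Y : Vec (Fin s) n) →
  (∀ q → ψ q (splice (suc (toℕ q)) X Y) ≡ lookup Y q) →
  (qs : List (Fin n)) (p : ℕ) → map toℕ qs ≡ downFrom p →
  run (map (λ q → ψ q , q) qs) (splice p X Y) ≡ Y
run-descending ψ X Y correct []       zero    _ = refl
run-descending ψ X Y correct (q ∷ qs) (suc p) eq with ∷-injective eq
... | refl , rest = begin
    run (map (λ q → ψ q , q) qs) (splice (suc (toℕ q)) X Y [ q ]≔ ψ q (splice (suc (toℕ q)) X Y))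
  ≡⟨ cong (λ Z → run (map (λ q → ψ q , q) qs) (splice (suc (toℕ q)) X Y [ q ]≔ Z)) (correct q) ⟩
    run (map (λ q → ψ q , q) qs) (splice (suc (toℕ q)) X Y [ q ]≔ lookup Y q)
  ≡⟨ cong (run (map (λ q → ψ q , q) qs)) (splice-update q X Y) ⟩
    run (map (λ q → ψ q , q) qs) (splice (toℕ q) X Y)
  ≡⟨ run-descending ψ X Y correct qs (toℕ q) rest ⟩
    Y ∎
  where open ≡-Reasoning

map-toℕ-tabulate : {m : ℕ} (n : ℕ) (f : Fin n → Fin m) (g : ℕ → ℕ) →
  (∀ x → toℕ (f x) ≡ g (toℕ x)) → map toℕ (tabulate f) ≡ applyUpTo g n
map-toℕ-tabulate zero    f g fg = refl
map-toℕ-tabulate (suc n) f g fg =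
  cong₂ _∷_ (fg Fin.zero) (map-toℕ-tabulate n (f ∘ Fin.suc) (g ∘ suc) (fg ∘ Fin.suc))

map-toℕ-descendingSignature : (n : ℕ) → map toℕ (descendingSignature n) ≡ downFrom n
map-toℕ-descendingSignature n = begin
  map toℕ (reverse (allFin n))  ≡⟨ reverse-map toℕ (allFin n) ⟩
  reverse (map toℕ (allFin n))  ≡⟨ cong reverse (map-toℕ-tabulate n (λ x → x) (λ x → x) (λ _ → refl)) ⟩
  reverse (applyUpTo (λ x → x) n) ≡⟨ reverse-upTo n ⟩
  downFrom n                    ∎
  where open ≡-Reasoning

signature-map : {s n : ℕ} (ψ : Fin n → Vec (Fin s) n → Fin s) (qs : List (Fin n)) →
  signature (map (λ q → ψ q , q) qs) ≡ qs
signature-map ψ qs = trans (sym (map-∘ qs)) (map-id qs)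

InjectiveOn : {A : Set} → (ℕ → A) → ℕ → ℕ → Set
InjectiveOn f lo hi = ∀ {m m'} → lo ≤ m → m ≤ hi → lo ≤ m' → m' ≤ hi → f m ≡ f m' → m ≡ m'

-- The largest m ≤ hi with f m ≡ a (and 0 if there is none).
searchDown : {A : Set} → DecidableEquality A → (ℕ → A) → ℕ → A → ℕ
searchDown _≟_ f zero    a = zero
searchDown _≟_ f (suc m) a with f (suc m) ≟ a
... | yes _ = suc m
... | no  _ = searchDown _≟_ f m a

searchDown-inverse : {A : Set} (_≟_ : DecidableEquality A) (f : ℕ → A) {lo hi : ℕ} →
  InjectiveOn f lo hi → ∀ {k} → lo ≤ k → k ≤ hi → searchDown _≟_ f hi (f k) ≡ k
searchDown-inverse _≟_ f {hi = zero}  inj lo≤k z≤n = refl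
searchDown-inverse _≟_ f {lo} {suc m} inj {k} lo≤k k≤hi with f (suc m) ≟ f k
... | yes same = inj (≤-trans lo≤k k≤hi) ≤-refl lo≤k k≤hi same
... | no  differ = searchDown-inverse _≟_ f (λ a b c d → inj a (m≤n⇒m≤1+n b) c (m≤n⇒m≤1+n d)) lo≤k k≤m
  where
  k≤m : k ≤ m
  k≤m with m≤n⇒m<n∨m≡n k≤hi
  ... | inj₁ k<hi = ≤-pred k<hi
  ... | inj₂ refl = ⊥-elim (differ refl)

stepwise-increasing⇒gap : (f : ℕ → ℕ) {i j : ℕ} → (∀ k → i ≤ k → k < j → f k < f (suc k)) →
  ∀ k d → i ≤ k → k + d ≤ j → f k + d ≤ f (k + d)
stepwise-increasing⇒gap f inc k zero    _   _ rewrite +-identityʳ k | +-identityʳ (f k) = ≤-refl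
stepwise-increasing⇒gap f inc k (suc d) i≤k k+d<j rewrite +-suc k d | +-suc (f k) d =
  ≤-trans (s≤s (stepwise-increasing⇒gap f inc k d i≤k (<⇒≤ k+d<j)))
          (inc (k + d) (≤-trans i≤k (m≤m+n k d)) k+d<j)

module _ (s' n : ℕ) (I : Vec (Fin (suc s')) n → Vec (Fin (suc s')) n) (i j : ℕ)
  (j<s^n : suc j < suc s' ^ n)
  (increasing : ∀ k → i ≤ k → k < j →
    index (I (vecOfIndex s' n k)) < index (I (vecOfIndex s' n (suc k))))
  where

  X : ℕ → Vec (Fin (suc s')) n
  X = vecOfIndex s' n

  state : ℕ → ℕ → Vec (Fin (suc s')) n
  state p k = splice p (X k) (I (X k))

  index-X : ∀ {k} → k ≤ j → index (X k) ≡ k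
  index-X k≤j = index-vecOfIndex s' n _ (<-trans (s≤s k≤j) j<s^n)

  state-distinct : ∀ p {k k'} → i ≤ k → k < k' → k' ≤ j → state p k ≢ state p k'
  state-distinct p {k} {k'} i≤k k<k' k'≤j same = <⇒≱ gap<s^p s^p≤gap
    where
    d = k' ∸ k
    k+d≡k' : k + d ≡ k'
    k+d≡k' = m+[n∸m]≡n (<⇒≤ k<k')
    sameLow : lowPart p (X k) ≡ lowPart p (X k')
    sameLow = begin
      lowPart p (X k)          ≡⟨ sym (lowPart-splice p (X k) _) ⟩
      lowPart p (state p k)    ≡⟨ cong (lowPart p) same ⟩
      lowPart p (state p k')   ≡⟨ lowPart-splice p (X k') _ ⟩
      lowPart p (X k')         ∎
      where open ≡-Reasoning
    sameHigh : highPart p (I (X k)) ≡ highPart p (I (X k'))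
    sameHigh = begin
      highPart p (I (X k))     ≡⟨ sym (highPart-splice p _ (I (X k))) ⟩
      highPart p (state p k)   ≡⟨ cong (highPart p) same ⟩
      highPart p (state p k')  ≡⟨ highPart-splice p _ (I (X k')) ⟩
      highPart p (I (X k'))    ∎
      where open ≡-Reasoning
    indexGap : index (X k) + d ≡ index (X k')
    indexGap = begin
      index (X k) + d  ≡⟨ cong (_+ d) (index-X (≤-trans (<⇒≤ k<k') k'≤j)) ⟩
      k + d            ≡⟨ k+d≡k' ⟩
      k'               ≡⟨ sym (index-X k'≤j) ⟩
      index (X k')     ∎
      where open ≡-Reasoning
    imageGap : index (I (X k)) + d ≤ index (I (X k'))
    imageGap = subst (λ m → index (I (X k)) + d ≤ index (I (X m))) k+d≡k'
      (stepwise-increasing⇒gap (index ∘ I ∘ X) increasing k d i≤k (subst (_≤ j) (sym k+d≡k') k'≤j))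
    s^p≤gap : suc s' ^ p ≤ d
    s^p≤gap = sameLowPart⇒s^p≤gap p d (X k) (X k') sameLow indexGap (m<n⇒0<n∸m k<k')
    gap<s^p : d < suc s' ^ p
    gap<s^p = sameHighPart⇒gap<s^p p d (I (X k)) (I (X k')) sameHigh imageGap

  state-injective : ∀ p → InjectiveOn (state p) i j
  state-injective p {k} {k'} i≤k k≤j i≤k' k'≤j same with <-cmp k k'
  ... | tri< k<k' _ _ = ⊥-elim (state-distinct p i≤k k<k' k'≤j same)
  ... | tri≈ _ k≡k' _ = k≡k'
  ... | tri> _ _ k'<k = ⊥-elim (state-distinct p i≤k' k'<k k≤j (sym same))

  writeComponent : Fin n → Vec (Fin (suc s')) n → Fin (suc s')
  writeComponent q Z = lookup (I (X (searchDown (≡-dec Data.Fin._≟_) (state (suc (toℕ q))) j Z))) q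

  writeComponent-correct : ∀ {k} → i ≤ k → k ≤ j →
    ∀ q → writeComponent q (state (suc (toℕ q)) k) ≡ lookup (I (X k)) q
  writeComponent-correct i≤k k≤j q =
    cong (λ m → lookup (I (X m)) q) (searchDown-inverse _ _ (state-injective (suc (toℕ q))) i≤k k≤j)

corollary7 : (s' n : ℕ) → 1 ≤ n →
    (I : Vec (Fin (suc s')) n → Vec (Fin (suc s')) n) →
    (i j : ℕ) → i < j → suc j < suc s' ^ n →
    (∀ k → i ≤ k → k < j →
      index (I (vecOfIndex s' n k)) < index (I (vecOfIndex s' n (suc k)))) →
    Σ (Program (suc s') n) λ P →
      (signature P ≡ descendingSignature n) ×
      (∀ k → i ≤ k → k ≤ j → run P (vecOfIndex s' n k) ≡ I (vecOfIndex s' n k))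
corollary7 s' n _ I i j _ j<s^n increasing = program , signature-map ψ (descendingSignature n) , computes-I
  where
  ψ : Fin n → Vec (Fin (suc s')) n → Fin (suc s')
  ψ = writeComponent s' n I i j j<s^n increasing
  program : Program (suc s') n
  program = map (λ q → ψ q , q) (descendingSignature n)
  computes-I : ∀ k → i ≤ k → k ≤ j → run program (vecOfIndex s' n k) ≡ I (vecOfIndex s' n k)
  computes-I k i≤k k≤j = begin
      run program (vecOfIndex s' n k)
    ≡⟨ cong (run program) (sym (splice-full (vecOfIndex s' n k) _)) ⟩
      run program (splice n (vecOfIndex s' n k) (I (vecOfIndex s' n k)))
    ≡⟨ run-descending ψ _ _ (writeComponent-correct s' n I i j j<s^n increasing i≤k k≤j)
         (descendingSignature n) n (map-toℕ-descendingSignature n) ⟩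
      I (vecOfIndex s' n k) ∎
    where open ≡-Reasoning
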